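{- Let $A_1,\dots,A_r$ be finite abelian groups, and for each $i$ write $A_i=\prod_{j=1}^{l_i}C_{i,j}$ with cyclic $C_{i,j}$ and $|C_{i,j}|$ dividing $|C_{i,j+1}|$ for $j=1,\dots,l_i-1$ (invariant factor decomposition). Let $\widetilde G$ be the descending iterated wreath product of the groups $C_{1,1},C_{1,2},\dots,C_{1,l_1},C_{2,1},\dots,C_{r,l_r}$ taken in this (lexicographic) order, i.e. $\widetilde G=C_{1,1}\wr(C_{1,2}\wr(\cdots\wr C_{r,l_r})\cdots)$. Then there is an epimorphism from $\widetilde G$ onto $G=A_1\wr(A_2\wr(\cdots\wr A_r)\cdots)$.
   Context: For groups $H,G$, the standard wreath product $H\wr G$ is the set of pairs $(f,g)$, $f:G\to H$ a function, $g\in G$, with multiplication $(f_1,g_1)(f_2,g_2)=(f_1f_2^{g_1^{ -1}},g_1g_2)$, where $f^{g^{ -1}}(x)=f(xg)$. -}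

module Defs where

open import Level using (0ℓ)
open import Data.Nat.Base as ℕ using (ℕ)
open import Data.Integer.Base using (ℤ; +_; _+_; _-_; -_; _*_; 0ℤ)
import Data.Integer.Properties as ℤP
open import Data.Integer.Divisibility.Signed as Div using (divides) renaming (_∣_ to _∣ℤ_)
open import Data.Integer.Solver using (module +-*-Solver)
open import Data.Product using (Σ; _×_; _,_; proj₁; proj₂)
open import Data.List.Base using (List; []; _∷_)
open import Data.List.NonEmpty.Base using (List⁺; _∷_)
open import Function.Bundles using (Func)
open import Function.Definitions using (Surjective)
open import Algebra.Bundles using (Group)
import Algebra.Construct.DirectProduct as DP
open import Algebra.Morphism.Structures using (module GroupMorphisms)
open import Relation.Binary.PropositionalEquality using (_≡_; refl; sym; trans; subst)

-- The cyclic group ℤ/nℤ of order n (for n ≥ 1), realised as ℤ with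
-- congruence modulo n as its (setoid) equality.

module _ (n : ℕ) where
  private
    infix 4 _≈ₙ_
    _≈ₙ_ : ℤ → ℤ → Set
    x ≈ₙ y = (+ n) ∣ℤ (x - y)

    open +-*-Solver

    n∣0 : (+ n) ∣ℤ 0ℤ
    n∣0 = divides 0ℤ (sym (ℤP.*-zeroˡ (+ n)))

    ≡⇒≈ : ∀ {x y} → x ≡ y → x ≈ₙ y
    ≡⇒≈ {x} refl = subst ((+ n) ∣ℤ_) (sym (ℤP.+-inverseʳ x)) n∣0

    ≈-sym : ∀ {x y} → x ≈ₙ y → y ≈ₙ x
    ≈-sym {x} {y} p = subst ((+ n) ∣ℤ_) (solve 2 (λ x y → :- (x :- y) := y :- x) refl x y) (Div.∣m⇒∣-m p)

    ≈-trans : ∀ {x y z} → x ≈ₙ y → y ≈ₙ z → x ≈ₙ z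
    ≈-trans {x} {y} {z} p q = subst ((+ n) ∣ℤ_) (solve 3 (λ x y z → (x :- y) :+ (y :- z) := x :- z) refl x y z) (Div.∣m∣n⇒∣m+n p q)

    +-cong : ∀ {x y u v} → x ≈ₙ y → u ≈ₙ v → (x + u) ≈ₙ (y + v)
    +-cong {x} {y} {u} {v} p q = subst ((+ n) ∣ℤ_) (solve 4 (λ x y u v → (x :- y) :+ (u :- v) := (x :+ u) :- (y :+ v)) refl x y u v) (Div.∣m∣n⇒∣m+n p q)

    neg-cong : ∀ {x y} → x ≈ₙ y → (- x) ≈ₙ (- y)
    neg-cong {x} {y} p = subst ((+ n) ∣ℤ_) (solve 2 (λ x y → :- (x :- y) := (:- x) :- (:- y)) refl x y) (Div.∣m⇒∣-m p)

  ℤ/ : Group 0ℓ 0ℓ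
  ℤ/ = record
    { Carrier = ℤ
    ; _≈_ = _≈ₙ_
    ; _∙_ = _+_
    ; ε = 0ℤ
    ; _⁻¹ = -_
    ; isGroup = record
      { isMonoid = record
        { isSemigroup = record
          { isMagma = record
            { isEquivalence = record { refl = λ {x} → ≡⇒≈ {x} {x} refl ; sym = λ {x} {y} → ≈-sym {x} {y} ; trans = λ {x} {y} {z} → ≈-trans {x} {y} {z} }
            ; ∙-cong = λ {x} {y} {u} {v} → +-cong {x} {y} {u} {v} }
          ; assoc = λ x y z → ≡⇒≈ {x + y + z} {x + (y + z)} (ℤP.+-assoc x y z) }
        ; identity = (λ x → ≡⇒≈ {0ℤ + x} {x} (ℤP.+-identityˡ x)) , (λ x → ≡⇒≈ {x + 0ℤ} {x} (ℤP.+-identityʳ x)) }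
      ; inverse = (λ x → ≡⇒≈ {(- x) + x} {0ℤ} (ℤP.+-inverseˡ x)) , (λ x → ≡⇒≈ {x - x} {0ℤ} (ℤP.+-inverseʳ x))
      ; ⁻¹-cong = λ {x} {y} → neg-cong {x} {y}
      }
    }

-- Multiplication:
--   (f₁ , g₁) (f₂ , g₂) = (x ↦ f₁ x · f₂ (x g₁) , g₁ g₂),
-- i.e. (f₁ f₂^{g₁⁻¹} , g₁ g₂) with f^{g⁻¹}(x) = f (x g).

module _ (H G : Group 0ℓ 0ℓ) where
  private
    module H = Group H
    module G = Group G
    open Func using (to)

    Base : Set
    Base = Func G.setoid H.setoid

    W : Set
    W = Base × G.Carrier

    infix 4 _≈W_
    _≈W_ : W → W → Set
    (f , g) ≈W (f′ , g′) = (∀ x → to f x H.≈ to f′ x) × (g G.≈ g′)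

    mul : W → W → W
    mul (f₁ , g₁) (f₂ , g₂) =
      record { to = λ x → to f₁ x H.∙ to f₂ (x G.∙ g₁)
             ; cong = λ p → H.∙-cong (Func.cong f₁ p) (Func.cong f₂ (G.∙-congʳ p)) }
      , g₁ G.∙ g₂

    one : W
    one = record { to = λ _ → H.ε ; cong = λ _ → H.refl } , G.ε

    inv : W → W
    inv (f , g) =
      record { to = λ x → to f (x G.∙ g G.⁻¹) H.⁻¹
             ; cong = λ p → H.⁻¹-cong (Func.cong f (G.∙-congʳ p)) }
      , g G.⁻¹

    xgg⁻¹ : ∀ x g → (x G.∙ g) G.∙ g G.⁻¹ G.≈ x
    xgg⁻¹ x g = G.trans (G.assoc x g (g G.⁻¹)) (G.trans (G.∙-congˡ (G.inverseʳ g)) (G.identityʳ x))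

  infixr 7 _≀_
  _≀_ : Group 0ℓ 0ℓ
  _≀_ = record
    { Carrier = W
    ; _≈_ = _≈W_
    ; _∙_ = mul
    ; ε = one
    ; _⁻¹ = inv
    ; isGroup = record
      { isMonoid = record
        { isSemigroup = record
          { isMagma = record
            { isEquivalence = record
              { refl = (λ _ → H.refl) , G.refl
              ; sym = λ (p , q) → (λ x → H.sym (p x)) , G.sym q
              ; trans = λ (p , q) (p′ , q′) → (λ x → H.trans (p x) (p′ x)) , G.trans q q′ }
            ; ∙-cong = λ {(f₁ , g₁)} {(f₁′ , g₁′)} {(f₂ , g₂)} {(f₂′ , g₂′)} (p₁ , q₁) (p₂ , q₂) →
                (λ x → H.∙-cong (p₁ x) (H.trans (Func.cong f₂ (G.∙-congˡ q₁)) (p₂ (x G.∙ g₁′))))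
                , G.∙-cong q₁ q₂ }
          ; assoc = λ (f₁ , g₁) (f₂ , g₂) (f₃ , g₃) →
              (λ x → H.trans (H.assoc _ _ _)
                       (H.∙-congˡ (H.∙-congˡ (Func.cong f₃ (G.sym (G.assoc x g₁ g₂))))))
              , G.assoc g₁ g₂ g₃ }
        ; identity =
            (λ (f , g) → (λ x → H.trans (H.identityˡ _) (Func.cong f (G.identityʳ x))) , G.identityˡ g)
          , (λ (f , g) → (λ x → H.identityʳ _) , G.identityʳ g) }
      ; inverse =
          (λ (f , g) → (λ x → H.inverseˡ _) , G.inverseˡ g)
        , (λ (f , g) → (λ x → H.trans (H.∙-congˡ (H.⁻¹-cong (Func.cong f (xgg⁻¹ x g)))) (H.inverseʳ _))
                       , G.inverseʳ g)
      ; ⁻¹-cong = λ {(f , g)} {(f′ , g′)} (p , q) →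
          (λ x → H.⁻¹-cong (H.trans (Func.cong f (G.∙-congˡ (G.⁻¹-cong q))) (p _)))
          , G.⁻¹-cong q
      }
    }

iterWreath′ : Group 0ℓ 0ℓ → List (Group 0ℓ 0ℓ) → Group 0ℓ 0ℓ
iterWreath′ H []       = H
iterWreath′ H (K ∷ Ks) = H ≀ iterWreath′ K Ks

IteratedWreath : List⁺ (Group 0ℓ 0ℓ) → Group 0ℓ 0ℓ
IteratedWreath (H ∷ Hs) = iterWreath′ H Hs

dirProd′ : Group 0ℓ 0ℓ → List (Group 0ℓ 0ℓ) → Group 0ℓ 0ℓ
dirProd′ H []       = H
dirProd′ H (K ∷ Ks) = DP.group H (dirProd′ K Ks)

DirectProduct : List⁺ (Group 0ℓ 0ℓ) → Group 0ℓ 0ℓ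
DirectProduct (H ∷ Hs) = dirProd′ H Hs

Epimorphism : Group 0ℓ 0ℓ → Group 0ℓ 0ℓ → Set
Epimorphism G H =
  Σ (Group.Carrier G → Group.Carrier H) λ φ →
    GroupMorphisms.IsGroupHomomorphism (Group.rawGroup G) (Group.rawGroup H) φ
    × Surjective (Group._≈_ G) (Group._≈_ H) φ

module Submission where

-- Its engine is one lemma (module
-- Absorb): if H is abelian, X and Y are finite and ρ = (κ , p) : X ↠ K ≀ Y,
-- then summing functions X → H over the fibres of p gives an epimorphism
-- H ≀ X ↠ (H × K) ≀ Y.  With K trivial this makes H ≀ - preserve
-- epimorphisms, with Y trivial it turns X ↠ K into H ≀ X ↠ H × K.  Iterating,
-- a run C₁ ≀ (C₂ ≀ ⋯ ≀ (C_l ≀ Z)) of abelian factors collapses onto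
-- (C₁ × ⋯ × C_l) ≀ W whenever Z ↠ W, and the theorem follows by induction
-- on the blocks A_i = C_{i,1} × ⋯ × C_{i,l_i}.

open import Defs
open import Data.Nat.Base using (ℕ; _≤_)
open import Data.Nat.Divisibility using (_∣_)
open import Data.Product using (_×_)
open import Data.List.NonEmpty.Base using (List⁺; toList; map; concat)
open import Data.List.Relation.Unary.All using (All)
open import Data.List.Relation.Unary.Linked using (Linked)

open import Level using (0ℓ)
open import Data.Nat.Base as ℕ using (zero; suc; _<_; _*_; _^_)
import Data.Nat.Properties as ℕP
open import Data.Nat.Divisibility using (>⇒∤)
open import Data.Integer.Base as ℤ using (ℤ; +_; _-_; _%ℕ_; _/ℕ_)
import Data.Integer.Properties as ℤP
open import Data.Integer.DivMod using (n%ℕd<d; a≡a%ℕn+[a/ℕn]*n)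
open import Data.Integer.Divisibility.Signed using (divides; ∣⇒∣ᵤ)
open import Data.Integer.Solver using (module +-*-Solver)
open import Data.Fin.Base using (Fin; zero; suc; punchIn; toℕ; fromℕ<; combine; remQuot; funToFin; finToFun)
import Data.Fin.Properties as FinP
open import Data.Fin.Permutation using (permutation)
open import Data.Vec.Functional using (removeAt)
open import Data.List.Base as List using ([]; _∷_; _++_)
open import Data.List.NonEmpty.Base using (_∷_)
open import Data.List.Properties using (++-identityʳ; map-++)
import Data.List.Relation.Unary.All as All
open import Data.List.Relation.Unary.All using ([]; _∷_)
open import Data.List.Relation.Unary.All.Properties using (++⁺; map⁺; concat⁺)
open import Data.Product using (∃; _,_; proj₁; proj₂)
open import Data.Product.Relation.Binary.Pointwise.NonDependent using (Pointwise)
open import Data.Unit.Polymorphic using (tt)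
open import Function.Base using (_∘_; id)
open import Function.Bundles using (Func)
open import Function.Definitions using (Surjective)
import Function.Construct.Identity as IdFun
import Function.Construct.Composition as CompFun
import Function.Relation.Binary.Setoid.Equality as FuncEq
open import Algebra.Bundles using (Group; CommutativeMonoid)
open import Algebra.Definitions using (Commutative)
import Algebra.Construct.DirectProduct as DP
import Algebra.Construct.Terminal {0ℓ} {0ℓ} as Trivial
open import Algebra.Morphism.Structures using (module GroupMorphisms)
open GroupMorphisms using (IsGroupHomomorphism)
import Algebra.Morphism.Construct.Identity as IdHom
import Algebra.Morphism.Construct.Composition as CompHom
import Algebra.Properties.Group as GP
open import Relation.Binary.Core using (Rel)
open import Relation.Binary.Bundles using (Setoid)
open import Relation.Binary.Definitions using (Decidable)
import Relation.Binary.Reasoning.Setoid as Reasoning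
open import Relation.Binary.PropositionalEquality as ≡ using (_≡_; cong; cong₂)
open import Relation.Nullary.Decidable using (Dec; yes; no; map′)
open import Relation.Nullary.Negation using (¬_; contradiction)

-- It is indexed by the bare
-- relation, so that finiteness of H × G and H ≀ G is literally finiteness of
-- a product and a function setoid.
record Finite {A : Set} (_≈_ : Rel A 0ℓ) : Set where
  field
    size       : ℕ
    elem       : Fin size → A
    index      : A → Fin size
    index-cong : ∀ {x y} → x ≈ y → index x ≡ index y
    elem-index : ∀ x → elem (index x) ≈ x
    index-elem : ∀ i → index (elem i) ≡ i

FiniteGroup : Group 0ℓ 0ℓ → Set
FiniteGroup G = Finite (Group._≈_ G)

module FiniteSetoid (S : Setoid 0ℓ 0ℓ) (F : Finite (Setoid._≈_ S)) where
  open Setoid S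
  open Finite F public

  index-injective : ∀ {x y} → index x ≡ index y → x ≈ y
  index-injective {x} {y} eq =
    trans (sym (elem-index x)) (trans (reflexive (cong elem eq)) (elem-index y))

  infix 4 _≟_
  _≟_ : Decidable _≈_
  x ≟ y = map′ index-injective index-cong (index x FinP.≟ index y)

finite-× : ∀ {A B : Set} {_≈₁_ : Rel A 0ℓ} {_≈₂_ : Rel B 0ℓ} →
           Finite _≈₁_ → Finite _≈₂_ → Finite (Pointwise _≈₁_ _≈₂_)
finite-× {_≈₁_ = _≈₁_} {_≈₂_} F₁ F₂ = record
  { size       = F₁.size * F₂.size
  ; elem       = λ k → let (i , j) = remQuot F₂.size k in F₁.elem i , F₂.elem j
  ; index      = λ (x , y) → combine (F₁.index x) (F₂.index y)
  ; index-cong = λ (p , q) → cong₂ combine (F₁.index-cong p) (F₂.index-cong q)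
  ; elem-index = λ (x , y) →
      ≡.subst (λ (i , j) → Pointwise _≈₁_ _≈₂_ (F₁.elem i , F₂.elem j) (x , y))
              (≡.sym (FinP.remQuot-combine (F₁.index x) (F₂.index y)))
              (F₁.elem-index x , F₂.elem-index y)
  ; index-elem = λ k →
      ≡.trans (cong₂ combine (F₁.index-elem _) (F₂.index-elem _)) (FinP.combine-remQuot {F₁.size} F₂.size k)
  }
  where module F₁ = Finite F₁; module F₂ = Finite F₂

funToFin-cong : ∀ {m n} {f g : Fin m → Fin n} → (∀ i → f i ≡ g i) → funToFin f ≡ funToFin g
funToFin-cong {zero}  _  = ≡.refl
funToFin-cong {suc m} eq = cong₂ combine (eq zero) (funToFin-cong (eq ∘ suc))

finite-⇨ : (S T : Setoid 0ℓ 0ℓ) → Finite (Setoid._≈_ S) → Finite (Setoid._≈_ T) →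
           Finite (FuncEq._≈_ S T)
finite-⇨ S T FS FT = record
  { size       = FT.size ^ FS.size
  ; elem       = λ k → record
      { to   = λ x → FT.elem (finToFun k (FS.index x))
      ; cong = λ p → T.reflexive (cong (FT.elem ∘ finToFun k) (FS.index-cong p)) }
  ; index      = table
  ; index-cong = λ p → funToFin-cong (λ i → FT.index-cong (p (FS.elem i)))
  ; elem-index = λ f x → T.trans
      (T.reflexive (cong FT.elem (FinP.finToFun-funToFin (λ i → FT.index (Func.to f (FS.elem i))) (FS.index x))))
      (T.trans (FT.elem-index _) (Func.cong f (FS.elem-index x)))
  ; index-elem = λ k → ≡.trans
      (funToFin-cong (λ i → ≡.trans (FT.index-elem _) (cong (finToFun k) (FS.index-elem i))))
      (FinP.funToFin-finToFin {FS.size} {FT.size} k)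
  }
  where
  module S = Setoid S
  module T = Setoid T
  module FS = Finite FS
  module FT = Finite FT
  table : Func S T → Fin (FT.size ^ FS.size)
  table f = funToFin (λ i → FT.index (Func.to f (FS.elem i)))

finite-DirectProduct : ∀ G H → FiniteGroup G → FiniteGroup H → FiniteGroup (DP.group G H)
finite-DirectProduct _ _ = finite-×

finite-≀ : ∀ H G → FiniteGroup H → FiniteGroup G → FiniteGroup (H ≀ G)
finite-≀ H G FH FG = finite-× (finite-⇨ (Group.setoid G) (Group.setoid H) FG FH) FG

-- ℤ/n (n ≥ 1) is finite: every class has exactly one representative in [0, n).
module _ (n : ℕ) .{{_ : ℕ.NonZero n}} where
  open Group (ℤ/ n) using (_≈_; sym)
  open +-*-Solver

  remainder≈ : ∀ x → + (x %ℕ n) ≈ x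
  remainder≈ x = divides (ℤ.- (x /ℕ n)) (begin
    + (x %ℕ n) - x
      ≡⟨ cong (λ y → + (x %ℕ n) - y) (a≡a%ℕn+[a/ℕn]*n x n) ⟩
    + (x %ℕ n) - (+ (x %ℕ n) ℤ.+ (x /ℕ n) ℤ.* + n)
      ≡⟨ solve 3 (λ r q d → r :- (r :+ q :* d) := (:- q) :* d) ≡.refl (+ (x %ℕ n)) (x /ℕ n) (+ n) ⟩
    ℤ.- (x /ℕ n) ℤ.* + n ∎)
    where open ≡.≡-Reasoning

  -- Two congruent residues in [0, n) coincide: their distance is a
  -- multiple of n smaller than n.
  residue-unique : ∀ {r s} → r < n → s < n → + r ≈ + s → r ≡ s
  residue-unique {r} {s} r<n s<n n∣r-s with ℤ.∣ + r - + s ∣ in distance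
  ... | zero  = ℤP.+-injective (ℤP.i-j≡0⇒i≡j (+ r) (+ s) (ℤP.∣i∣≡0⇒i≡0 distance))
  ... | suc k = contradiction (≡.subst (n ∣_) distance (∣⇒∣ᵤ n∣r-s)) (>⇒∤ (≡.subst (_< n) distance small))
    where
    small : ℤ.∣ + r - + s ∣ < n
    small = ℕP.≤-<-trans
      (≡.subst (_≤ r ℕ.⊔ s) (cong ℤ.∣_∣ (≡.sym (ℤP.m-n≡m⊖n r s))) (ℤP.∣m⊝n∣≤m⊔n r s))
                         (ℕP.⊔-pres-<m r<n s<n)

  finite-ℤ/ : FiniteGroup (ℤ/ n)
  finite-ℤ/ = record
    { size       = n
    ; elem       = λ i → + toℕ i
    ; index      = index
    ; index-cong = λ {x} {y} x≈y → FinP.toℕ-injective (≡.trans (toℕ-index x) (≡.trans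
        (residue-unique (n%ℕd<d x n) (n%ℕd<d y n) (remainders≈ {x} {y} x≈y))
        (≡.sym (toℕ-index y))))
    ; elem-index = λ x → ≡.subst (λ r → + r ≈ x) (≡.sym (toℕ-index x)) (remainder≈ x)
    ; index-elem = λ i → FinP.toℕ-injective (≡.trans (toℕ-index (+ toℕ i))
        (residue-unique (n%ℕd<d (+ toℕ i) n) (FinP.toℕ<n i) (remainder≈ (+ toℕ i))))
    }
    where
    index : ℤ → Fin n
    index x = fromℕ< (n%ℕd<d x n)
    toℕ-index : ∀ x → toℕ (index x) ≡ x %ℕ n
    toℕ-index x = FinP.toℕ-fromℕ< (n%ℕd<d x n)
    remainders≈ : ∀ {x y} → x ≈ y → + (x %ℕ n) ≈ + (y %ℕ n)
    remainders≈ {x} {y} x≈y = begin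
      + (x %ℕ n) ≈⟨ remainder≈ x ⟩
      x          ≈⟨ x≈y ⟩
      y          ≈⟨ sym {+ (y %ℕ n)} {y} (remainder≈ y) ⟩
      + (y %ℕ n) ∎
      where open Reasoning (Group.setoid (ℤ/ n))

Abelian : Group 0ℓ 0ℓ → Set
Abelian G = Commutative _≈_ _∙_ where open Group G

abelian-ℤ/ : ∀ n → Abelian (ℤ/ n)
abelian-ℤ/ n x y = Group.reflexive (ℤ/ n) (ℤP.+-comm x y)

abelian-× : ∀ G H → Abelian G → Abelian H → Abelian (DP.group G H)
abelian-× _ _ commG commH (a , b) (c , d) = commG a c , commH b d

FiniteAbelian : Group 0ℓ 0ℓ → Set
FiniteAbelian G = FiniteGroup G × Abelian G

abelianMonoid : (H : Group 0ℓ 0ℓ) → Abelian H → CommutativeMonoid 0ℓ 0ℓ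
abelianMonoid H comm = record { isCommutativeMonoid = record { isMonoid = Group.isMonoid H ; comm = comm } }

finite-iterWreath : ∀ H Hs → FiniteGroup H → All FiniteGroup Hs → FiniteGroup (iterWreath′ H Hs)
finite-iterWreath H []       finH []            = finH
finite-iterWreath H (K ∷ Ks) finH (finK ∷ finKs) = finite-≀ H (iterWreath′ K Ks) finH (finite-iterWreath K Ks finK finKs)

finiteAbelian-dirProd : ∀ H Hs → FiniteAbelian H → All FiniteAbelian Hs → FiniteAbelian (dirProd′ H Hs)
finiteAbelian-dirProd H []       finH []            = finH
finiteAbelian-dirProd H (K ∷ Ks) (finH , H-abelian) (finK ∷ finKs) =
  let (finP , P-abelian) = finiteAbelian-dirProd K Ks finK finKs
  in finite-DirectProduct H (dirProd′ K Ks) finH finP , abelian-× H (dirProd′ K Ks) H-abelian P-abelian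

-- Epimorphisms wrapped in a record, so that source and target are
-- recoverable from the type (Epimorphism itself unfolds to a Σ-type).
infix 4 _↠_
record _↠_ (G H : Group 0ℓ 0ℓ) : Set where
  constructor ⟨_⟩
  field epi : Epimorphism G H
  private
    module G = Group G
    module H = Group H

  fun : G.Carrier → H.Carrier
  fun = proj₁ epi

  fun-cong : ∀ {x y} → x G.≈ y → fun x H.≈ fun y
  fun-cong = IsGroupHomomorphism.⟦⟧-cong (proj₁ (proj₂ epi))

  fun-homo : ∀ x y → fun (x G.∙ y) H.≈ fun x H.∙ fun y
  fun-homo = IsGroupHomomorphism.homo (proj₁ (proj₂ epi))

  preimage : ∀ y → ∃ λ x → fun x H.≈ y
  preimage y = let (x , onto) = proj₂ (proj₂ epi) y in x , onto G.refl

module _ (G H : Group 0ℓ 0ℓ) where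
  private
    module G = Group G
    module H = Group H

  mk↠ : (f : G.Carrier → H.Carrier) →
        (∀ {x y} → x G.≈ y → f x H.≈ f y) →
        (∀ x y → f (x G.∙ y) H.≈ f x H.∙ f y) →
        (∀ y → ∃ λ x → f x H.≈ y) →
        G ↠ H
  mk↠ f f-cong f-homo f-onto = ⟨ f , isHomomorphism , surjective ⟩
    where
    ε-homo : f G.ε H.≈ H.ε
    ε-homo = GP.identityʳ-unique H (f G.ε) (f G.ε)
               (H.trans (H.sym (f-homo G.ε G.ε)) (f-cong (G.identityʳ G.ε)))
    isHomomorphism : IsGroupHomomorphism G.rawGroup H.rawGroup f
    isHomomorphism = record
      { isMonoidHomomorphism = record
        { isMagmaHomomorphism = record
          { isRelHomomorphism = record { cong = f-cong }
          ; homo = f-homo }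
        ; ε-homo = ε-homo }
      ; ⁻¹-homo = λ x → GP.inverseʳ-unique H (f x) (f (x G.⁻¹))
          (H.trans (H.sym (f-homo x (x G.⁻¹))) (H.trans (f-cong (G.inverseʳ x)) ε-homo)) }
    surjective : Surjective G._≈_ H._≈_ f
    surjective y = let (x , fx≈y) = f-onto y in x , λ z≈x → H.trans (f-cong z≈x) fx≈y

id↠ : (G : Group 0ℓ 0ℓ) → G ↠ G
id↠ G = ⟨ id , IdHom.isGroupHomomorphism (Group.rawGroup G) (Group.refl G) , IdFun.surjective (Group._≈_ G) ⟩

infixr 9 _∘↠_
_∘↠_ : ∀ {G H K} → H ↠ K → G ↠ H → G ↠ K
_∘↠_ {G} {H} {K} ⟨ g , g-hom , g-onto ⟩ ⟨ f , f-hom , f-onto ⟩ = ⟨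
  g ∘ f
  , CompHom.isGroupHomomorphism (Group.trans K) f-hom g-hom
  , CompFun.surjective (Group._≈_ G) (Group._≈_ H) (Group._≈_ K) f-onto g-onto ⟩

constant : (Y K : Group 0ℓ 0ℓ) → Group.Carrier K → Func (Group.setoid Y) (Group.setoid K)
constant Y K k = record { to = λ _ → k ; cong = λ _ → Group.refl K }

top : (K Y : Group 0ℓ 0ℓ) → K ≀ Y ↠ Y
top K Y = mk↠ (K ≀ Y) Y proj₂ proj₂ (λ _ _ → Group.refl Y)
  (λ y → (constant Y K (Group.ε K) , y) , Group.refl Y)

-- An epimorphism onto a finite group has a section respecting equality:
-- pick a preimage of the chosen representative of each class.
module Section {X Y : Group 0ℓ 0ℓ} (finY : FiniteGroup Y) (π : X ↠ Y) where
  private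
    module X = Group X
    module Y = Group Y
    module FY = FiniteSetoid Y.setoid finY
    module π = _↠_ π

  σ : Y.Carrier → X.Carrier
  σ y = proj₁ (π.preimage (FY.elem (FY.index y)))

  σ-cong : ∀ {y y′} → y Y.≈ y′ → σ y X.≈ σ y′
  σ-cong y≈y′ = X.reflexive (cong (λ i → proj₁ (π.preimage (FY.elem i))) (FY.index-cong y≈y′))

  π∘σ : ∀ y → π.fun (σ y) Y.≈ y
  π∘σ y = Y.trans (proj₂ (π.preimage (FY.elem (FY.index y)))) (FY.elem-index y)

module FiniteSums (M : CommutativeMonoid 0ℓ 0ℓ) where
  open CommutativeMonoid M
  open import Algebra.Properties.CommutativeMonoid.Sum M public using (sum; sum-cong-≋; ∑-distrib-+; ∑-permute)
  open import Algebra.Properties.CommutativeMonoid.Sum M using (sum-remove; sum-replicate-zero)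

  when : ∀ {P : Set} → Dec P → Carrier → Carrier
  when (yes _) a = a
  when (no _)  _ = ε

  when-yes : ∀ {P : Set} (d : Dec P) → P → ∀ a → when d a ≈ a
  when-yes (yes _) _ _ = refl
  when-yes (no ¬p) p _ = contradiction p ¬p

  when-no : ∀ {P : Set} (d : Dec P) → ¬ P → ∀ a → when d a ≈ ε
  when-no (yes p) ¬p _ = contradiction p ¬p
  when-no (no _)  _  _ = refl

  when-cong : ∀ {P Q : Set} (dP : Dec P) (dQ : Dec Q) → (P → Q) → (Q → P) →
              ∀ {a b} → (P → a ≈ b) → when dP a ≈ when dQ b
  when-cong (yes p) (yes _) _   _   a≈b = a≈b p
  when-cong (yes p) (no ¬q) P→Q _   _   = contradiction (P→Q p) ¬q
  when-cong (no ¬p) (yes q) _   Q→P _   = contradiction (Q→P q) ¬p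
  when-cong (no _)  (no _)  _   _   _   = refl

  when-when : ∀ {P Q R : Set} (dP : Dec P) (dQ : Dec Q) (dR : Dec R) →
              (P → Q → R) → (R → P) → (R → Q) →
              ∀ {a b} → (R → a ≈ b) → when dP (when dQ a) ≈ when dR b
  when-when (yes p) dQ dR PQ→R R→P R→Q a≈b =
    when-cong dQ dR (PQ→R p) R→Q (a≈b ∘ PQ→R p)
  when-when (no ¬p) dQ dR PQ→R R→P R→Q a≈b =
    sym (when-no dR (¬p ∘ R→P) _)

  when-∙ : ∀ {P : Set} (d : Dec P) a b → when d (a ∙ b) ≈ when d a ∙ when d b
  when-∙ (yes _) _ _ = refl
  when-∙ (no _)  _ _ = sym (identityˡ ε)

  sum-point : ∀ {n} (j : Fin n) a → sum (λ i → when (i FinP.≟ j) a) ≈ a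
  sum-point {suc n} j a = begin
    sum t                         ≈⟨ sum-remove {i = j} t ⟩
    t j ∙ sum (removeAt t j)      ≈⟨ ∙-cong (when-yes (j FinP.≟ j) ≡.refl a) (sum-cong-≋ others) ⟩
    a ∙ sum (λ (_ : Fin n) → ε)   ≈⟨ ∙-congˡ (sum-replicate-zero n) ⟩
    a ∙ ε                         ≈⟨ identityʳ a ⟩
    a                             ∎
    where
    open Reasoning setoid
    t = λ i → when (i FinP.≟ j) a
    others : ∀ k → removeAt t j k ≈ ε
    others k = when-no (punchIn j k FinP.≟ j) (FinP.punchInᵢ≢i j k) a

  module OverFiniteGroup (X : Group 0ℓ 0ℓ) (finX : FiniteGroup X) where
    private
      module X = Group X
    open FiniteSetoid (Group.setoid X) finX

    ∑ : (X.Carrier → Carrier) → Carrier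
    ∑ h = sum (λ i → h (elem i))

    ∑-cong : ∀ {h h′ : X.Carrier → Carrier} → (∀ x → h x ≈ h′ x) → ∑ h ≈ ∑ h′
    ∑-cong h≈h′ = sum-cong-≋ (h≈h′ ∘ elem)

    shift : X.Carrier → Fin size → Fin size
    shift g i = index (elem i X.∙ g)

    shift-shift : ∀ {g g′} → g X.∙ g′ X.≈ X.ε → ∀ i → shift g′ (shift g i) ≡ i
    shift-shift {g} {g′} gg′≈ε i = ≡.trans (index-cong moved-back) (index-elem i)
      where
      open Reasoning X.setoid
      moved-back : elem (shift g i) X.∙ g′ X.≈ elem i
      moved-back = begin
        elem (shift g i) X.∙ g′  ≈⟨ X.∙-congʳ (elem-index _) ⟩
        (elem i X.∙ g) X.∙ g′    ≈⟨ X.assoc _ _ _ ⟩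
        elem i X.∙ (g X.∙ g′)    ≈⟨ X.∙-congˡ gg′≈ε ⟩
        elem i X.∙ X.ε           ≈⟨ X.identityʳ _ ⟩
        elem i                   ∎

    ∑-translate : ∀ (h : X.Carrier → Carrier) → (∀ {x y} → x X.≈ y → h x ≈ h y) →
                  ∀ g → ∑ (λ x → h (x X.∙ g)) ≈ ∑ h
    ∑-translate h h-cong g = sym (trans (∑-permute (h ∘ elem) π)
                                        (sum-cong-≋ {size} λ i → h-cong (elem-index (elem i X.∙ g))))
      where
      π = permutation (shift g) (shift (g X.⁻¹))
            (shift-shift (X.inverseˡ g)) (shift-shift (X.inverseʳ g))

    ∑-point : ∀ c a → ∑ (λ x → when (x ≟ c) a) ≈ a
    ∑-point c a = trans (sum-cong-≋ λ i → when-cong (elem i ≟ c) (i FinP.≟ index c) to from (λ _ → refl))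
                        (sum-point (index c) a)
      where
      to : ∀ {i} → elem i X.≈ c → i ≡ index c
      to {i} eq = ≡.trans (≡.sym (index-elem i)) (index-cong eq)
      from : ∀ {i} → i ≡ index c → elem i X.≈ c
      from ≡.refl = elem-index c

module Absorb (H K X Y : Group 0ℓ 0ℓ) (H-abelian : Abelian H)
              (finX : FiniteGroup X) (finY : FiniteGroup Y) (ρ : X ↠ K ≀ Y) where
  private
    module H = Group H
    module K = Group K
    module X = Group X
    module Y = Group Y
    module H≀X = Group (H ≀ X)
    module FX = FiniteSetoid X.setoid finX
    module FY = FiniteSetoid Y.setoid finY
    open FiniteSums (abelianMonoid H H-abelian)
    open OverFiniteGroup X finX
    open Func using (to)

    module ρ = _↠_ ρ
    κ : X.Carrier → Func Y.setoid K.setoid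
    κ x = proj₁ (ρ.fun x)
    pEpi : X ↠ Y
    pEpi = top K Y ∘↠ ρ
    open _↠_ pEpi using () renaming (fun to p; fun-cong to p-cong; fun-homo to p-homo)
    open Section finY pEpi

  push : Func X.setoid H.setoid → Y.Carrier → H.Carrier
  push f y = ∑ (λ x → when (p x FY.≟ y) (to f x))

  push-cong : ∀ {f f′} → (∀ x → to f x H.≈ to f′ x) → ∀ {y y′} → y Y.≈ y′ → push f y H.≈ push f′ y′
  push-cong f≈f′ y≈y′ = ∑-cong λ x → when-cong (p x FY.≟ _) (p x FY.≟ _)
    (λ e → Y.trans e y≈y′) (λ e → Y.trans e (Y.sym y≈y′)) (λ _ → f≈f′ x)

  fibre-translate : ∀ x x₁ y → p x Y.≈ y → p (x X.∙ x₁) Y.≈ y Y.∙ p x₁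
  fibre-translate x x₁ y e = Y.trans (p-homo x x₁) (Y.∙-congʳ e)

  fibre-untranslate : ∀ x x₁ y → p (x X.∙ x₁) Y.≈ y Y.∙ p x₁ → p x Y.≈ y
  fibre-untranslate x x₁ y e = GP.∙-cancelʳ Y (p x₁) (p x) y (Y.trans (Y.sym (p-homo x x₁)) e)

  push-∙ : ∀ f₁ x₁ f₂ x₂ y →
           push (proj₁ ((f₁ , x₁) H≀X.∙ (f₂ , x₂))) y H.≈ push f₁ y H.∙ push f₂ (y Y.∙ p x₁)
  push-∙ f₁ x₁ f₂ x₂ y = begin
    ∑ (λ x → when (p x FY.≟ y) (to f₁ x H.∙ to f₂ (x X.∙ x₁)))
      ≈⟨ ∑-cong (λ x → when-∙ (p x FY.≟ y) (to f₁ x) (to f₂ (x X.∙ x₁))) ⟩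
    ∑ (λ x → u x H.∙ v x)
      ≈⟨ ∑-distrib-+ (u ∘ FX.elem) (v ∘ FX.elem) ⟩
    push f₁ y H.∙ ∑ v
      ≈⟨ H.∙-congˡ (∑-cong λ x → when-cong (p x FY.≟ y) (p (x X.∙ x₁) FY.≟ y′)
                     (fibre-translate x x₁ y) (fibre-untranslate x x₁ y) (λ _ → H.refl {to f₂ (x X.∙ x₁)})) ⟩
    push f₁ y H.∙ ∑ (λ x → g (x X.∙ x₁))
      ≈⟨ H.∙-congˡ (∑-translate g g-cong x₁) ⟩
    push f₁ y H.∙ push f₂ y′ ∎
    where
    open Reasoning H.setoid
    y′ = y Y.∙ p x₁
    u v : X.Carrier → H.Carrier
    u x = when (p x FY.≟ y) (to f₁ x)
    v x = when (p x FY.≟ y) (to f₂ (x X.∙ x₁))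
    g : X.Carrier → H.Carrier
    g x = when (p x FY.≟ y′) (to f₂ x)
    g-cong : ∀ {x x′} → x X.≈ x′ → g x H.≈ g x′
    g-cong x≈x′ = when-cong (_ FY.≟ y′) (_ FY.≟ y′)
      (Y.trans (Y.sym (p-cong x≈x′))) (Y.trans (p-cong x≈x′)) (λ _ → Func.cong f₂ x≈x′)

  -- Every h : Y → H is a pushforward: place h (p x) at the chosen point σ (p x)
  -- of each fibre and ε elsewhere.
  lift : Func Y.setoid H.setoid → Func X.setoid H.setoid
  lift h = record
    { to   = λ x → when (x FX.≟ σ (p x)) (to h (p x))
    ; cong = λ x≈x′ → when-cong (_ FX.≟ _) (_ FX.≟ _)
        (λ e → X.trans (X.sym x≈x′) (X.trans e (σ-cong (p-cong x≈x′))))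
        (λ e → X.trans x≈x′ (X.trans e (σ-cong (Y.sym (p-cong x≈x′)))))
        (λ _ → Func.cong h (p-cong x≈x′)) }

  push-lift : ∀ h y → push (lift h) y H.≈ to h y
  push-lift h y = H.trans
    (∑-cong λ x → when-when (p x FY.≟ y) (x FX.≟ σ (p x)) (x FX.≟ σ y)
                    (λ px≈y x≈σpx → X.trans x≈σpx (σ-cong px≈y))
                    in-fibre
                    (λ x≈σy → X.trans x≈σy (σ-cong (Y.sym (in-fibre x≈σy))))
                    (λ x≈σy → Func.cong h (in-fibre x≈σy)))
    (∑-point (σ y) (to h y))
    where
    in-fibre : ∀ {x} → x X.≈ σ y → p x Y.≈ y
    in-fibre x≈σy = Y.trans (p-cong x≈σy) (π∘σ y)

  Φ : H≀X.Carrier → Group.Carrier (DP.group H K ≀ Y)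
  Φ (f , x) = record { to   = λ y → push f y , to (κ x) y
                     ; cong = λ y≈y′ → push-cong {f} {f} (λ _ → H.refl) y≈y′ , Func.cong (κ x) y≈y′ }
            , p x

  epi : H ≀ X ↠ DP.group H K ≀ Y
  epi = mk↠ (H ≀ X) (DP.group H K ≀ Y) Φ
    (λ {(f , _)} {(f′ , _)} (f≈f′ , x≈x′) →
       (λ y → push-cong {f} {f′} f≈f′ Y.refl , proj₁ (ρ.fun-cong x≈x′) y) , p-cong x≈x′)
    (λ (f₁ , x₁) (f₂ , x₂) →
       (λ y → push-∙ f₁ x₁ f₂ x₂ y , proj₁ (ρ.fun-homo x₁ x₂) y) , p-homo x₁ x₂)
    onto
    where
    -- given (G , y₀), lift the H-part of G and realise (K-part of G , y₀) through ρ
    onto : ∀ w → ∃ λ z → Group._≈_ (DP.group H K ≀ Y) (Φ z) w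
    onto (G , y₀) = (lift hG , x₀) , (λ y → push-lift hG y , proj₁ ρx₀≈ y) , proj₂ ρx₀≈
      where
      hG : Func Y.setoid H.setoid
      hG = record { to = proj₁ ∘ to G ; cong = proj₁ ∘ Func.cong G }
      kG : Func Y.setoid K.setoid
      kG = record { to = proj₂ ∘ to G ; cong = proj₂ ∘ Func.cong G }
      x₀ = proj₁ (ρ.preimage (kG , y₀))
      ρx₀≈ = proj₂ (ρ.preimage (kG , y₀))

One : Group 0ℓ 0ℓ
One = Trivial.group

finite-One : FiniteGroup One
finite-One = record
  { size = 1 ; elem = λ _ → tt ; index = λ _ → zero ; index-cong = λ _ → ≡.refl
  ; elem-index = λ _ → tt ; index-elem = λ { zero → ≡.refl } }

into-≀One : (K : Group 0ℓ 0ℓ) → K ↠ K ≀ One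
into-≀One K = mk↠ K (K ≀ One) (λ k → constant One K k , tt)
  (λ k≈k′ → (λ _ → k≈k′) , tt) (λ _ _ → (λ _ → Group.refl K) , tt)
  (λ (g , _) → Func.to g tt , (λ _ → Func.cong g tt) , tt)

outof-≀One : (K : Group 0ℓ 0ℓ) → K ≀ One ↠ K
outof-≀One K = mk↠ (K ≀ One) K (λ (g , _) → Func.to g tt)
  (λ (g≈g′ , _) → g≈g′ tt) (λ _ _ → Group.refl K)
  (λ k → (constant One K k , tt) , Group.refl K)

over-One : ∀ {X Y} → X ↠ Y → X ↠ One ≀ Y
over-One {X} {Y} π = mk↠ X (One ≀ Y) (λ x → constant Y One tt , π.fun x)
  (λ x≈x′ → (λ _ → tt) , π.fun-cong x≈x′)
  (λ x x′ → (λ _ → tt) , π.fun-homo x x′)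
  (λ (_ , y) → proj₁ (π.preimage y) , (λ _ → tt) , proj₂ (π.preimage y))
  where module π = _↠_ π

drop-One : ∀ H Y → DP.group H One ≀ Y ↠ H ≀ Y
drop-One H Y = mk↠ (DP.group H One ≀ Y) (H ≀ Y) forget
  (λ (g≈g′ , y≈y′) → (proj₁ ∘ g≈g′) , y≈y′) (λ _ _ → (λ _ → Group.refl H) , Group.refl Y)
  (λ (g , y) → (record { to = λ y → Func.to g y , tt ; cong = λ e → Func.cong g e , tt } , y)
               , (λ _ → Group.refl H) , Group.refl Y)
  where
  forget : Group.Carrier (DP.group H One ≀ Y) → Group.Carrier (H ≀ Y)
  forget (g , y) = record { to = proj₁ ∘ Func.to g ; cong = proj₁ ∘ Func.cong g } , y

pushforward : ∀ H X Y → Abelian H → FiniteGroup X → FiniteGroup Y → X ↠ Y → H ≀ X ↠ H ≀ Y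
pushforward H X Y H-abelian finX finY π =
  drop-One H Y ∘↠ Absorb.epi H One X Y H-abelian finX finY (over-One π)

absorb-top : ∀ H X K → Abelian H → FiniteGroup X → X ↠ K → H ≀ X ↠ DP.group H K
absorb-top H X K H-abelian finX ρ =
  outof-≀One (DP.group H K) ∘↠ Absorb.epi H K X One H-abelian finX finite-One (into-≀One K ∘↠ ρ)

collapse : ∀ H Ks Z W → Abelian H → All FiniteAbelian Ks → FiniteGroup Z → FiniteGroup W →
           Z ↠ W → iterWreath′ H (Ks ++ Z ∷ []) ↠ dirProd′ H Ks ≀ W
collapse H []       Z W H-abelian []                       finZ finW π = pushforward H Z W H-abelian finZ finW π
collapse H (K ∷ Ks) Z W H-abelian ((finK , K-abelian) ∷ finKs) finZ finW π =
  Absorb.epi H (dirProd′ K Ks) (iterWreath′ K (Ks ++ Z ∷ [])) W H-abelian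
    (finite-iterWreath K (Ks ++ Z ∷ []) finK (++⁺ (All.map proj₁ finKs) (finZ ∷ [])))
    finW (collapse K Ks Z W K-abelian finKs finZ finW π)

collapse-bottom : ∀ H Ks → Abelian H → All FiniteAbelian Ks → iterWreath′ H Ks ↠ dirProd′ H Ks
collapse-bottom H []       _         []                        = id↠ H
collapse-bottom H (K ∷ Ks) H-abelian ((finK , K-abelian) ∷ finKs) =
  absorb-top H (iterWreath′ K Ks) (dirProd′ K Ks) H-abelian (finite-iterWreath K Ks finK (All.map proj₁ finKs))
             (collapse-bottom K Ks K-abelian finKs)

-- Wreath products nest to the right, so a tail of the tower is a single factor.
iterWreath-++ : ∀ H Ks L Ls → iterWreath′ H (Ks ++ L ∷ Ls) ≡ iterWreath′ H (Ks ++ iterWreath′ L Ls ∷ [])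
iterWreath-++ H []       L Ls = ≡.refl
iterWreath-++ H (K ∷ Ks) L Ls = cong (H ≀_) (iterWreath-++ K Ks L Ls)

module Blocks {A : Set} (C : A → Group 0ℓ 0ℓ) where

  block : List⁺ A → Group 0ℓ 0ℓ
  block b = DirectProduct (map C b)

  FiniteAbelianBlocks : List⁺ (List⁺ A) → Set
  FiniteAbelianBlocks bs = All (λ b → All (FiniteAbelian ∘ C) (toList b)) (toList bs)

  finite-tower : ∀ a as → All (FiniteAbelian ∘ C) (a ∷ as) → FiniteGroup (iterWreath′ (C a) (List.map C as))
  finite-tower a as ((finC , _) ∷ fins) = finite-iterWreath (C a) (List.map C as) finC (map⁺ (All.map proj₁ fins))

  finiteAbelian-block : ∀ b → All (FiniteAbelian ∘ C) (toList b) → FiniteAbelian (block b)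
  finiteAbelian-block (a ∷ as) (finC ∷ fins) = finiteAbelian-dirProd (C a) (List.map C as) finC (map⁺ fins)

  finite-source : ∀ bs → FiniteAbelianBlocks bs → FiniteGroup (IteratedWreath (map C (concat bs)))
  finite-source ((a ∷ as) ∷ bs) fins = finite-tower a _ (concat⁺ (map⁺ fins))

  finite-target : ∀ bs → FiniteAbelianBlocks bs → FiniteGroup (IteratedWreath (map block bs))
  finite-target (b ∷ bs) (fin ∷ fins) =
    finite-iterWreath (block b) (List.map block bs) (proj₁ (finiteAbelian-block b fin))
      (map⁺ (All.map (λ {b′} → proj₁ ∘ finiteAbelian-block b′) fins))

  -- Induction on the blocks: collapse the first block above the epimorphism
  -- obtained for the remaining ones; the last block collapses at the bottom.
  wreath-blocks : ∀ bs → FiniteAbelianBlocks bs → IteratedWreath (map C (concat bs)) ↠ IteratedWreath (map block bs)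
  wreath-blocks ((a ∷ as) ∷ []) ((finC ∷ fins) ∷ []) =
    ≡.subst (_↠ block (a ∷ as)) (cong (iterWreath′ (C a) ∘ List.map C) (≡.sym (++-identityʳ as)))
      (collapse-bottom (C a) (List.map C as) (proj₂ finC) (map⁺ fins))
  wreath-blocks ((a ∷ as) ∷ (a′ ∷ as′) ∷ bs) ((finC ∷ fins) ∷ fins′) =
    ≡.subst (_↠ block (a ∷ as) ≀ W) (≡.sym tower)
      (collapse (C a) (List.map C as) Z W (proj₂ finC) (map⁺ fins)
                (finite-source rest fins′) (finite-target rest fins′) (wreath-blocks rest fins′))
    where
    rest = (a′ ∷ as′) ∷ bs
    Z = IteratedWreath (map C (concat rest))
    W = IteratedWreath (map block rest)
    later = as′ ++ List.concat (List.map toList bs)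
    tower : iterWreath′ (C a) (List.map C (as ++ a′ ∷ later)) ≡ iterWreath′ (C a) (List.map C as ++ Z ∷ [])
    tower = ≡.trans (cong (iterWreath′ (C a)) (map-++ C as (a′ ∷ later)))
                    (iterWreath-++ (C a) (List.map C as) (C a′) (List.map C later))

open Blocks using (wreath-blocks)

-- The theorem: cyclic groups ℤ/n with n ≥ 1 are finite abelian, so the block
-- theorem applies (the divisibility chain of the invariant factors is unused).
finiteAbelian-ℤ/ : ∀ {n} → 1 ≤ n → FiniteAbelian (ℤ/ n)
finiteAbelian-ℤ/ {n} 1≤n = finite-ℤ/ n {{ℕ.>-nonZero 1≤n}} , abelian-ℤ/ n

proposition2p17 : (orders : List⁺ (List⁺ ℕ)) →
    All (λ ns → All (λ n → 1 ≤ n) (toList ns) × Linked _∣_ (toList ns)) (toList orders) →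
    Epimorphism
      (IteratedWreath (map ℤ/ (concat orders)))
      (IteratedWreath (map (λ ns → DirectProduct (map ℤ/ ns)) orders))
proposition2p17 orders hyps =
  _↠_.epi (wreath-blocks ℤ/ orders (All.map (All.map finiteAbelian-ℤ/ ∘ proj₁) hyps))
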